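{- Let $k\geq3$ and let $Q_k$ be the graph constructed as follows. Start with a $k$-clique $K$ and a set $S$ of $2k^2+1$ new pairwise nonadjacent vertices, each adjacent to every vertex of $K$. For each $v\in S$, choose three distinct vertices $x_1,x_2,x_3\in K$, and for each $i\in\{1,2,3\}$ add a set of four new pairwise nonadjacent vertices, each adjacent exactly to the vertices of $(K\cup\{v\})\setminus\{x_i\}$. Then $\operatorname{bt}(Q_k)\geq k+1$.
   Context: A book embedding of a graph places its vertices injectively at points in convex position in the plane and draws edges as straight segments; two edges cross if they intersect at a point other than a common endpoint. The book thickness $\operatorname{bt}(G)$ is the minimum $t$ such that some book embedding of $G$ has its edges partitioned into $t$ classes with no two edges of the same class crossing. -}

module Defs where

open import Data.Nat using (ℕ; _+_; _*_; _<_; _≤_)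
open import Data.Fin using (Fin)
open import Data.Product using (_×_; Σ; ∃; ∃-syntax)
open import Data.Sum using (_⊎_)
open import Data.Empty using (⊥)
open import Data.Unit using (⊤)
open import Relation.Nullary using (¬_)
open import Relation.Binary.PropositionalEquality using (_≡_; _≢_)
open import Function.Definitions using (Injective)

sSize : ℕ → ℕ
sSize k = 2 * (k * k) + 1

-- Vertices of Q_k:
--   kv a        : vertex a of the clique K (a : Fin k)
--   sv v        : vertex v of the independent set S
--   tv v i j    : the j-th (j < 4) new vertex attached for v ∈ S and index i ∈ {1,2,3}
data QV (k : ℕ) : Set where
  kv : Fin k → QV k
  sv : Fin (sSize k) → QV k
  tv : Fin (sSize k) → Fin 3 → Fin 4 → QV k

Choice : ℕ → Set
Choice k = Fin (sSize k) → Fin 3 → Fin k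

ValidChoice : (k : ℕ) → Choice k → Set
ValidChoice k ch = ∀ v → Injective _≡_ _≡_ (ch v)

Adj : (k : ℕ) → Choice k → QV k → QV k → Set
Adj k ch (kv a)     (kv b)     = a ≢ b
Adj k ch (kv a)     (sv v)     = ⊤
Adj k ch (sv v)     (kv a)     = ⊤
Adj k ch (tv v i j) (kv a)     = a ≢ ch v i
Adj k ch (kv a)     (tv v i j) = a ≢ ch v i
Adj k ch (tv v i j) (sv w)     = w ≡ v
Adj k ch (sv w)     (tv v i j) = w ≡ v
Adj k ch _          _          = ⊥

-- Book embeddings: vertices in convex position are determined (for crossing
-- purposes) by their cyclic order, which we represent by an injective
-- placement pos : V → ℕ (read cyclically).
Between : ℕ → ℕ → ℕ → Set
Between p q r = (p < r × r < q) ⊎ (q < r × r < p)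

-- Chords ab and cd of the convex polygon cross iff the four endpoints are
-- distinct and they interleave: exactly one of c, d lies between a and b.
Cross : {V : Set} → (V → ℕ) → V → V → V → V → Set
Cross pos a b c d =
  (pos a ≢ pos b) × (pos a ≢ pos c) × (pos a ≢ pos d) ×
  (pos b ≢ pos c) × (pos b ≢ pos d) × (pos c ≢ pos d) ×
  ((Between (pos a) (pos b) (pos c) × ¬ Between (pos a) (pos b) (pos d)) ⊎
   (Between (pos a) (pos b) (pos d) × ¬ Between (pos a) (pos b) (pos c)))

-- bt(G) ≥ t+1 : for every book embedding (injective placement) and every
-- partition of the edges into t classes (a colouring of unordered edges,
-- given as a function on ordered pairs that is symmetric on edges), some two
-- edges of the same class cross.
BookThicknessGT : {V : Set} → (V → V → Set) → ℕ → Set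
BookThicknessGT {V} E t =
  (pos : V → ℕ) → Injective _≡_ _≡_ pos →
  (col : V → V → Fin t) → (∀ a b → E a b → col a b ≡ col b a) →
  ∃[ a ] ∃[ b ] ∃[ c ] ∃[ d ]
    (E a b × E c d × col a b ≡ col c d × Cross pos a b c d)

-- Cutting the circle twice, we read the embedding on a line on which 2k+1 vertices
-- S₀ < S₁ < … < S₂ₖ of S precede the whole clique K: after a first cut right behind a clique
-- vertex, the k clique vertices split S into k gaps, one of which holds 2k+1 of the 2k²+1
-- vertices of S; the second cut goes just before the first of them.
--
-- Rank the clique vertices along the line by r < k. Edges a S_{g a} with g strictly
-- increasing in r cross pairwise, so such a fan uses all k colours and every further edge
-- shares its colour with a fan edge. Well-chosen fans show, for v = S_k: the stars from
-- S_{k-1}, S_k, S_{k+1} to K are rainbow; the twelve neighbours of v outside K lie between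
-- S_{k-1} and S_{k+1}; for such a neighbour w of class i and a ≠ xᵢ, the edges a w and a v
-- have the same colour; and if w lies between v and another neighbour w′, then v w′ has the
-- colour of xᵢ v. By pigeonhole two classes i ≠ i′ have two neighbours each on one side of
-- v. The farthest of these four from v has one neighbour of class i and one of class i′
-- nearer to v, so xᵢ v and xᵢ′ v get the colour of v w′, contradicting the rainbow star at v.

module Submission where

open import Defs
open import Data.Bool using (if_then_else_)
open import Data.Fin as Fin using (Fin; zero; suc; punchIn)
import Data.Fin.Properties as Finₚ
open import Data.Nat using (ℕ; zero; suc; _+_; _*_; _⊔_; _<_; _≤_; _>_; _≮_; _≯_; z≤n; s≤s; _<?_; _≤?_)
open import Data.Nat.Properties
open import Data.Product using (_×_; _,_; proj₁; proj₂; Σ; ∃; ∃₂; ∃-syntax)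
open import Data.Sum using (_⊎_; inj₁; inj₂; [_,_]′)
open import Data.Unit using (tt)
open import Data.Vec.Functional using (_∷_)
open import Function using (_∘_; id)
open import Function.Definitions using (Injective)
open import Relation.Binary.Definitions using (Tri; tri<; tri≈; tri>)
open import Relation.Binary.PropositionalEquality using (_≡_; _≢_; refl; sym; trans; cong; subst)
open import Relation.Binary.Structures using (IsStrictTotalOrder)
import Relation.Binary.Construct.Flip.EqAndOrd as Flip
open import Relation.Nullary using (yes; no; ¬_; contradiction)
open import Relation.Nullary.Decidable using (isYes)

-- x, y, z, w occur in this order around the circle; fromᵢ reads it as a chain starting at
-- the i-th point.
data Cyclic (x y z w : ℕ) : Set where
  from₁ : x < y → y < z → z < w → Cyclic x y z w
  from₂ : y < z → z < w → w < x → Cyclic x y z w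
  from₃ : z < w → w < x → x < y → Cyclic x y z w
  from₄ : w < x → x < y → y < z → Cyclic x y z w

Cyclic-shift : ∀ {x y z w} → Cyclic x y z w → Cyclic w x y z
Cyclic-shift (from₁ xy yz zw) = from₂ xy yz zw
Cyclic-shift (from₂ yz zw wx) = from₃ yz zw wx
Cyclic-shift (from₃ zw wx xy) = from₄ zw wx xy
Cyclic-shift (from₄ wx xy yz) = from₁ wx xy yz

module _ {V : Set} (pos : V → ℕ) where

  private
    Between-swap : ∀ {p q r} → Between p q r → Between q p r
    Between-swap (inj₁ h) = inj₂ h
    Between-swap (inj₂ h) = inj₁ h

  Cross-swapˡ : ∀ {a b c d} → Cross pos a b c d → Cross pos b a c d
  Cross-swapˡ (ab , ac , ad , bc , bd , cd , inj₁ (c∈ , d∉)) =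
    ab ∘ sym , bc , bd , ac , ad , cd , inj₁ (Between-swap c∈ , d∉ ∘ Between-swap)
  Cross-swapˡ (ab , ac , ad , bc , bd , cd , inj₂ (d∈ , c∉)) =
    ab ∘ sym , bc , bd , ac , ad , cd , inj₂ (Between-swap d∈ , c∉ ∘ Between-swap)

  Cross-swapʳ : ∀ {a b c d} → Cross pos a b c d → Cross pos a b d c
  Cross-swapʳ (ab , ac , ad , bc , bd , cd , inj₁ h) = ab , ad , ac , bd , bc , cd ∘ sym , inj₂ h
  Cross-swapʳ (ab , ac , ad , bc , bd , cd , inj₂ h) = ab , ad , ac , bd , bc , cd ∘ sym , inj₁ h

  Cross-sorted : ∀ {a b c d} → pos a < pos c → pos c < pos b → pos b < pos d → Cross pos a b c d
  Cross-sorted a<c c<b b<d =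
    <⇒≢ a<b , <⇒≢ a<c , <⇒≢ a<d , >⇒≢ c<b , <⇒≢ b<d , <⇒≢ c<d ,
    inj₁ (inj₁ (a<c , c<b) , λ { (inj₁ (_ , d<b)) → <-asym b<d d<b ; (inj₂ (_ , d<a)) → <-asym a<d d<a })
    where
    a<b = <-trans a<c c<b
    a<d = <-trans a<b b<d
    c<d = <-trans c<b b<d

  Cross-sorted′ : ∀ {a b c d} → pos c < pos a → pos a < pos d → pos d < pos b → Cross pos a b c d
  Cross-sorted′ c<a a<d d<b =
    <⇒≢ a<b , >⇒≢ c<a , <⇒≢ a<d , >⇒≢ c<b , >⇒≢ d<b , <⇒≢ c<d ,
    inj₂ (inj₁ (a<d , d<b) , λ { (inj₁ (a<c , _)) → <-asym a<c c<a ; (inj₂ (b<c , _)) → <-asym b<c c<b })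
    where
    a<b = <-trans a<d d<b
    c<d = <-trans c<a a<d
    c<b = <-trans c<d d<b

  Cyclic⇒Cross : ∀ {a b c d} → Cyclic (pos a) (pos c) (pos b) (pos d) → Cross pos a b c d
  Cyclic⇒Cross (from₁ a<c c<b b<d) = Cross-sorted a<c c<b b<d
  Cyclic⇒Cross (from₂ c<b b<d d<a) = Cross-swapˡ (Cross-sorted′ c<b b<d d<a)
  Cyclic⇒Cross (from₃ b<d d<a a<c) = Cross-swapˡ (Cross-swapʳ (Cross-sorted b<d d<a a<c))
  Cyclic⇒Cross (from₄ d<a a<c c<b) = Cross-swapʳ (Cross-sorted′ d<a a<c c<b)

-- Cutting the circle just before t: positions ≥ t stay, smaller ones move beyond B. On
-- positions ≤ B this preserves the cyclic order.
module Rotation (B t : ℕ) where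

  rotate : ℕ → ℕ
  rotate p with t ≤? p
  ... | yes _ = p
  ... | no _ = suc (B + p)

  data Rotated (p : ℕ) : ℕ → Set where
    kept  : t ≤ p → Rotated p p
    moved : p < t → Rotated p (suc (B + p))

  rotated : ∀ p → Rotated p (rotate p)
  rotated p with t ≤? p
  ... | yes t≤p = kept t≤p
  ... | no t≰p = moved (≰⇒> t≰p)

  private
    B<moved : ∀ {p b} → b ≤ B → b < suc (B + p)
    B<moved {p} b≤B = s≤s (≤-trans b≤B (m≤m+n B p))

    moved≮kept : ∀ {p b} → b ≤ B → ¬ suc (B + p) < b
    moved≮kept b≤B lt = <-asym lt (B<moved b≤B)

    unmove : ∀ {p p'} → suc (B + p) < suc (B + p') → p < p'
    unmove lt = +-cancelˡ-< B _ _ (≤-pred lt)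

  rotate-≤ : ∀ {p} → p ≤ B → rotate p ≤ suc (B + B)
  rotate-≤ {p} p≤B with rotate p | rotated p
  ... | _ | kept _ = m≤n⇒m≤1+n (≤-trans p≤B (m≤m+n B B))
  ... | _ | moved _ = s≤s (+-monoʳ-≤ B p≤B)

  rotate-injective : ∀ {p p'} → p ≤ B → p' ≤ B → rotate p ≡ rotate p' → p ≡ p'
  rotate-injective {p} {p'} p≤B p'≤B eq with rotate p | rotated p | rotate p' | rotated p'
  ... | _ | kept _  | _ | kept _  = eq
  ... | _ | moved _ | _ | moved _ = +-cancelˡ-≡ B _ _ (suc-injective eq)
  ... | _ | kept _  | _ | moved _ = contradiction eq (<⇒≢ (B<moved p≤B))
  ... | _ | moved _ | _ | kept _  = contradiction eq (>⇒≢ (B<moved p'≤B))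

  rotate-chain : ∀ {x y z w} → y ≤ B → z ≤ B → w ≤ B →
                 rotate x < rotate y → rotate y < rotate z → rotate z < rotate w → Cyclic x y z w
  rotate-chain {x} {y} {z} {w} y≤B z≤B w≤B x<y y<z z<w
    with rotate x | rotated x | rotate y | rotated y | rotate z | rotated z | rotate w | rotated w
  ... | _ | kept _   | _ | kept _ | _ | kept _  | _ | kept _    = from₁ x<y y<z z<w
  ... | _ | moved _  | _ | moved _ | _ | moved _ | _ | moved _  = from₁ (unmove x<y) (unmove y<z) (unmove z<w)
  ... | _ | kept t≤x | _ | moved _ | _ | moved _ | _ | moved w<t = from₂ (unmove y<z) (unmove z<w) (<-≤-trans w<t t≤x)
  ... | _ | kept t≤x | _ | kept _  | _ | moved _ | _ | moved w<t = from₃ (unmove z<w) (<-≤-trans w<t t≤x) x<y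
  ... | _ | kept t≤x | _ | kept _  | _ | kept _  | _ | moved w<t = from₄ (<-≤-trans w<t t≤x) x<y y<z
  ... | _ | moved _  | _ | kept _  | _ | _       | _ | _        = contradiction x<y (moved≮kept y≤B)
  ... | _ | _        | _ | moved _ | _ | kept _  | _ | _        = contradiction y<z (moved≮kept z≤B)
  ... | _ | _        | _ | _       | _ | moved _ | _ | kept _   = contradiction z<w (moved≮kept w≤B)

  rotate-cyclic : ∀ {x y z w} → x ≤ B → y ≤ B → z ≤ B → w ≤ B →
                  Cyclic (rotate x) (rotate y) (rotate z) (rotate w) → Cyclic x y z w
  rotate-cyclic x≤B y≤B z≤B w≤B (from₁ x<y y<z z<w) = rotate-chain y≤B z≤B w≤B x<y y<z z<w
  rotate-cyclic x≤B y≤B z≤B w≤B (from₂ y<z z<w w<x) =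
    Cyclic-shift (rotate-chain z≤B w≤B x≤B y<z z<w w<x)
  rotate-cyclic x≤B y≤B z≤B w≤B (from₃ z<w w<x x<y) =
    Cyclic-shift (Cyclic-shift (rotate-chain w≤B x≤B y≤B z<w w<x x<y))
  rotate-cyclic x≤B y≤B z≤B w≤B (from₄ w<x x<y y<z) =
    Cyclic-shift (Cyclic-shift (Cyclic-shift (rotate-chain x≤B y≤B z≤B w<x x<y y<z)))

  rotate-kept-mono : ∀ {p p'} → t ≤ p → p < p' → rotate p < rotate p'
  rotate-kept-mono {p} {p'} t≤p p<p' with rotate p | rotated p | rotate p' | rotated p'
  ... | _ | kept _ | _ | kept _ = p<p'
  ... | _ | moved p<t | _ | _ = contradiction t≤p (<⇒≱ p<t)
  ... | _ | kept _ | _ | moved p'<t = contradiction t≤p (<⇒≱ (<-trans p<p' p'<t))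

  rotate-kept<moved : ∀ {p p'} → p ≤ B → t ≤ p → p' < t → rotate p < rotate p'
  rotate-kept<moved {p} {p'} p≤B t≤p p'<t with rotate p | rotated p | rotate p' | rotated p'
  ... | _ | kept _ | _ | moved _ = B<moved p≤B
  ... | _ | moved p<t | _ | _ = contradiction t≤p (<⇒≱ p<t)
  ... | _ | _ | _ | kept t≤p' = contradiction t≤p' (<⇒≱ p'<t)

  rotate-≤-last : ∀ {c p} → t ≡ suc c → p ≤ B → rotate p ≤ rotate c
  rotate-≤-last {c} {p} refl p≤B with rotate p | rotated p | rotate c | rotated c
  ... | _ | kept _ | _ | moved _ = <⇒≤ (B<moved p≤B)
  ... | _ | moved p<t | _ | moved _ = s≤s (+-monoʳ-≤ B (≤-pred p<t))
  ... | _ | _ | _ | kept c<c = contradiction c<c (n≮n c)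


rank : ∀ {n} → (Fin n → ℕ) → ℕ → ℕ
rank {zero} f x = 0
rank {suc n} f x with f zero <? x
... | yes _ = suc (rank (f ∘ suc) x)
... | no _ = rank (f ∘ suc) x

rank-≤ : ∀ {n} (f : Fin n → ℕ) x → rank f x ≤ n
rank-≤ {zero} f x = z≤n
rank-≤ {suc n} f x with f zero <? x
... | yes _ = s≤s (rank-≤ (f ∘ suc) x)
... | no _ = m≤n⇒m≤1+n (rank-≤ (f ∘ suc) x)

rank-< : ∀ {n} (f : Fin n → ℕ) {x} i → x ≤ f i → rank f x < n
rank-< {suc n} f {x} zero x≤f with f zero <? x
... | yes f<x = contradiction x≤f (<⇒≱ f<x)
... | no _ = s≤s (rank-≤ (f ∘ suc) x)
rank-< {suc n} f {x} (suc i) x≤f with f zero <? x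
... | yes _ = s≤s (rank-< (f ∘ suc) i x≤f)
... | no _ = m<n⇒m<1+n (rank-< (f ∘ suc) i x≤f)

rank-mono : ∀ {n} (f : Fin n → ℕ) {x y} → x ≤ y → rank f x ≤ rank f y
rank-mono {zero} f x≤y = z≤n
rank-mono {suc n} f {x} {y} x≤y with f zero <? x | f zero <? y
... | yes _ | yes _ = s≤s (rank-mono (f ∘ suc) x≤y)
... | yes f<x | no f≮y = contradiction (<-≤-trans f<x x≤y) f≮y
... | no _ | yes _ = m≤n⇒m≤1+n (rank-mono (f ∘ suc) x≤y)
... | no _ | no _ = rank-mono (f ∘ suc) x≤y

rank-strict : ∀ {n} (f : Fin n → ℕ) {x y} i → x ≤ f i → f i < y → rank f x < rank f y
rank-strict {suc n} f {x} {y} zero x≤f f<y with f zero <? x | f zero <? y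
... | yes f<x | _ = contradiction x≤f (<⇒≱ f<x)
... | no _ | yes _ = s≤s (rank-mono (f ∘ suc) (≤-trans x≤f (<⇒≤ f<y)))
... | no _ | no f≮y = contradiction f<y f≮y
rank-strict {suc n} f {x} {y} (suc i) x≤f f<y with f zero <? x | f zero <? y
... | yes _ | yes _ = s≤s (rank-strict (f ∘ suc) i x≤f f<y)
... | yes f₀<x | no f₀≮y = contradiction (<-trans (<-≤-trans f₀<x x≤f) f<y) f₀≮y
... | no _ | yes _ = m<n⇒m<1+n (rank-strict (f ∘ suc) i x≤f f<y)
... | no _ | no _ = rank-strict (f ∘ suc) i x≤f f<y

sup : ∀ {n} → (Fin n → ℕ) → ℕ
sup {zero} f = 0
sup {suc n} f = f zero ⊔ sup (f ∘ suc)

≤-sup : ∀ {n} (f : Fin n → ℕ) i → f i ≤ sup f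
≤-sup f zero = m≤m⊔n _ _
≤-sup f (suc i) = ≤-trans (≤-sup (f ∘ suc) i) (m≤n⊔m _ _)

argmin : ∀ {n} (g : Fin (suc n) → ℕ) → ∃ λ m → ∀ i → g m ≤ g i
argmin {zero} g = zero , λ { zero → ≤-refl }
argmin {suc n} g with argmin (g ∘ suc)
... | m , min with g zero ≤? g (suc m)
... | yes g₀≤ = zero , λ { zero → ≤-refl ; (suc i) → ≤-trans g₀≤ (min i) }
... | no g₀≰ = suc m , λ { zero → <⇒≤ (≰⇒> g₀≰) ; (suc i) → min i }

sorted-enumeration : ∀ n (g : Fin (n + 1) → ℕ) → Injective _≡_ _≡_ g →
                     Σ (ℕ → Fin (n + 1)) λ σ → ∀ {i j} → i < j → j ≤ n → g (σ i) < g (σ j)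
sorted-enumeration zero g _ = (λ _ → zero) , λ i<j j≤0 → contradiction (<-≤-trans i<j j≤0) n≮0
sorted-enumeration (suc n) g g-injective with argmin g
... | m , min with sorted-enumeration n (g ∘ punchIn m) (Finₚ.punchIn-injective m _ _ ∘ g-injective)
... | σ , σ-sorted = σ′ , σ′-sorted
  where
  σ′ : ℕ → Fin (suc n + 1)
  σ′ zero = m
  σ′ (suc i) = punchIn m (σ i)

  σ′-sorted : ∀ {i j} → i < j → j ≤ suc n → g (σ′ i) < g (σ′ j)
  σ′-sorted {zero} {suc j} _ _ = ≤∧≢⇒< (min _) (Finₚ.punchInᵢ≢i m (σ j) ∘ sym ∘ g-injective)
  σ′-sorted {suc i} {suc j} (s≤s i<j) (s≤s j≤n) = σ-sorted i<j j≤n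

monotone-plateau : ∀ n m (L : ℕ → ℕ) → (∀ {i j} → i ≤ j → j ≤ n * m → L i ≤ L j) → L (n * m) < n →
                   ∃ λ j → m + j ≤ n * m × L j ≡ L (m + j)
monotone-plateau n m L L-mono L<n with climb n ≤-refl
  where
  climb : ∀ i → i ≤ n → (∃ λ j → m + j ≤ n * m × L j ≡ L (m + j)) ⊎ i ≤ L (i * m)
  climb zero _ = inj₂ z≤n
  climb (suc i) i<n with climb i (<⇒≤ i<n)
  ... | inj₁ found = inj₁ found
  ... | inj₂ i≤L with L (i * m) ≟ L (m + i * m)
  ...   | yes eq = inj₁ (i * m , *-monoˡ-≤ m i<n , eq)
  ...   | no ne = inj₂ (≤-<-trans i≤L (≤∧≢⇒< (L-mono (m≤n+m _ m) (*-monoˡ-≤ m i<n)) ne))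
... | inj₁ found = found
... | inj₂ n≤L = contradiction L<n (≤⇒≯ n≤L)

collision : ∀ {n} (c₀ : Fin n) (c : Fin n → Fin n) →
            (∃ λ d → c₀ ≡ c d) ⊎ (∃₂ λ d d' → d ≢ d' × c d ≡ c d')
collision {n} c₀ c with Finₚ.pigeonhole (n<1+n n) (c₀ ∷ c)
... | zero , suc d , _ , eq = inj₁ (d , eq)
... | suc d , suc d' , s≤s d<d' , eq = inj₂ (d , d' , Finₚ.<⇒≢ d<d' , eq)

∀-⊎ : ∀ {n} {P : Fin n → Set} {C : Set} → (∀ i → P i ⊎ C) → (∀ i → P i) ⊎ C
∀-⊎ {zero} h = inj₁ λ ()
∀-⊎ {suc n} h with h zero | ∀-⊎ (h ∘ suc)
... | inj₁ p₀ | inj₁ ps = inj₁ λ { zero → p₀ ; (suc i) → ps i }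
... | inj₂ c | _ = inj₂ c
... | _ | inj₂ c = inj₂ c

module _ {A : Set} {_≺_ : A → A → Set} (≺-isStrictTotalOrder : IsStrictTotalOrder _≡_ _≺_) where
  open IsStrictTotalOrder ≺-isStrictTotalOrder using (compare) renaming (trans to ≺-trans)

  private
    connex : ∀ {x y} → x ≢ y → x ≺ y ⊎ y ≺ x
    connex {x} {y} x≢y with compare x y
    ... | tri< x≺y _ _ = inj₁ x≺y
    ... | tri≈ _ x≡y _ = contradiction x≡y x≢y
    ... | tri> _ _ y≺x = inj₂ y≺x

  Dominated : (Fin 2 → Fin 2 → A) → Set
  Dominated p = ∃₂ λ c m → ∃₂ λ m₀ m₁ → p zero m₀ ≺ p c m × p (suc zero) m₁ ≺ p c m

  module _ (p : Fin 2 → Fin 2 → A) (in-class : ∀ c → p c zero ≢ p c (suc zero))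
           (apart : ∀ m m' → p zero m ≢ p (suc zero) m') where

    private
      beyond : ∀ m m' → p zero m ≺ p zero m' → Dominated p
      beyond m m' a≺a' with connex (apart m' zero)
      ... | inj₂ b≺a' = zero , m' , m , zero , a≺a' , b≺a'
      ... | inj₁ a'≺b with connex (in-class (suc zero))
      ...   | inj₂ b'≺b = suc zero , zero , m , suc zero , ≺-trans a≺a' a'≺b , b'≺b
      ...   | inj₁ b≺b' = suc zero , suc zero , m , zero , ≺-trans (≺-trans a≺a' a'≺b) b≺b' , b≺b'

    farthest : Dominated p
    farthest with connex (in-class zero)
    ... | inj₁ a≺a' = beyond zero (suc zero) a≺a'
    ... | inj₂ a'≺a = beyond (suc zero) zero a'≺a

Order : Fin 2 → ℕ → ℕ → Set
Order zero = _>_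
Order (suc zero) = _<_

Order-isStrictTotalOrder : ∀ s → IsStrictTotalOrder _≡_ (Order s)
Order-isStrictTotalOrder zero = Flip.isStrictTotalOrder <-isStrictTotalOrder
Order-isStrictTotalOrder (suc zero) = <-isStrictTotalOrder

Order-total : ∀ {x y} → x ≢ y → ∃ λ s → Order s x y
Order-total {x} {y} x≢y with <-cmp x y
... | tri< x<y _ _ = suc zero , x<y
... | tri≈ _ x≡y _ = contradiction x≡y x≢y
... | tri> _ _ y<x = zero , y<x

Order-Between : ∀ s {x y z} → Order s x y → Order s y z → Between x z y
Order-Between zero x>y y>z = inj₂ (y>z , x>y)
Order-Between (suc zero) x<y y<z = inj₁ (x<y , y<z)

MonochromaticCrossing : {V : Set} → (V → V → Set) → (V → ℕ) → {t : ℕ} → (V → V → Fin t) → Set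
MonochromaticCrossing E pos col =
  ∃[ a ] ∃[ b ] ∃[ c ] ∃[ d ] (E a b × E c d × col a b ≡ col c d × Cross pos a b c d)

module Core (k₁ : ℕ) (ch : Choice (suc k₁))
  (pos : QV (suc k₁) → ℕ) (col : QV (suc k₁) → QV (suc k₁) → Fin (suc k₁))
  (q : QV (suc k₁) → ℕ) (q-injective : Injective _≡_ _≡_ q)
  (q-cross : ∀ {a b c d} → Cyclic (q a) (q c) (q b) (q d) → Cross pos a b c d)
  (σ : ℕ → Fin (sSize (suc k₁)))
  (S-sorted : ∀ {i j} → i < j → j ≤ suc k₁ + suc k₁ → q (sv (σ i)) < q (sv (σ j)))
  (S<K : ∀ a → q (sv (σ (suc k₁ + suc k₁))) < q (kv a))
  where

  k : ℕ
  k = suc k₁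

  V : Set
  V = QV k

  E : V → V → Set
  E = Adj k ch

  Conflict : Set
  Conflict = MonochromaticCrossing E pos col

  conflict : ∀ {a b c d} → E a b → E c d → col a b ≡ col c d → Cyclic (q a) (q c) (q b) (q d) → Conflict
  conflict ab cd same cyc = _ , _ , _ , _ , ab , cd , same , q-cross cyc

  conflict′ : ∀ {a b c d} → E a b → E c d → col a b ≡ col c d → Cyclic (q a) (q d) (q b) (q c) → Conflict
  conflict′ ab cd same cyc = _ , _ , _ , _ , ab , cd , same , Cross-swapʳ pos (q-cross cyc)

  S : ℕ → V
  S i = sv (σ i)

  S-mono : ∀ {i j} → i ≤ j → j ≤ k + k → q (S i) ≤ q (S j)
  S-mono {i} {j} i≤j j≤2k with m≤n⇒m<n∨m≡n i≤j
  ... | inj₁ i<j = <⇒≤ (S-sorted i<j j≤2k)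
  ... | inj₂ refl = ≤-refl

  S-before-K : ∀ {j} a → j ≤ k + k → q (S j) < q (kv a)
  S-before-K a j≤2k = ≤-<-trans (S-mono j≤2k ≤-refl) (S<K a)

  Q : Fin k → ℕ
  Q a = q (kv a)

  r : Fin k → ℕ
  r a = rank Q (Q a)

  r<k : ∀ a → r a < k
  r<k a = rank-< Q a ≤-refl

  r-mono : ∀ {a b} → Q a < Q b → r a < r b
  r-mono {a} Qa<Qb = rank-strict Q a ≤-refl Qa<Qb

  kv-injective : ∀ {a b} → kv {k} a ≡ kv b → a ≡ b
  kv-injective refl = refl

  K-compare : ∀ {a b} → a ≢ b → Q a < Q b ⊎ Q b < Q a
  K-compare {a} {b} a≢b with <-cmp (Q a) (Q b)
  ... | tri< Qa<Qb _ _ = inj₁ Qa<Qb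
  ... | tri≈ _ Qa≡Qb _ = contradiction (kv-injective (q-injective Qa≡Qb)) a≢b
  ... | tri> _ _ Qb<Qa = inj₂ Qb<Qa

  r-reflects : ∀ {a b} → r a < r b → Q a < Q b
  r-reflects {a} {b} ra<rb with a Finₚ.≟ b
  ... | yes refl = contradiction ra<rb (n≮n (r a))
  ... | no a≢b with K-compare a≢b
  ...   | inj₁ Qa<Qb = Qa<Qb
  ...   | inj₂ Qb<Qa = contradiction ra<rb (<⇒≯ (r-mono Qb<Qa))

  r-injective : ∀ {a b} → r a ≡ r b → a ≡ b
  r-injective {a} {b} ra≡rb with a Finₚ.≟ b
  ... | yes a≡b = a≡b
  ... | no a≢b with K-compare a≢b
  ...   | inj₁ Qa<Qb = contradiction ra≡rb (<⇒≢ (r-mono Qa<Qb))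
  ...   | inj₂ Qb<Qa = contradiction ra≡rb (>⇒≢ (r-mono Qb<Qa))

  k₁≤k+1 : k₁ ≤ suc k
  k₁≤k+1 = ≤-trans (n≤1+n k₁) (n≤1+n k)

  k≤k+k : k ≤ k + k
  k≤k+k = m≤m+n k k

  k+1≤k+k : suc k ≤ k + k
  k+1≤k+k = s≤s (m≤n+m k k₁)

  r≤k+k : ∀ d → r d ≤ k + k
  r≤k+k d = ≤-trans (<⇒≤ (r<k d)) k≤k+k

  c+r≤k+k : ∀ {c} d → c ≤ suc k → c + r d ≤ k + k
  c+r≤k+k d c≤k+1 = ≤-trans (+-mono-≤ c≤k+1 (≤-pred (r<k d))) (≤-reflexive (sym (+-suc k k₁)))

  pigeonhole-edges : ∀ {x y} (u w : Fin k → V) →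
                     (∀ d d' → d ≢ d' → col (u d) (w d) ≡ col (u d') (w d') → Conflict) →
                     (∀ d → col x y ≡ col (u d) (w d) → Conflict) → Conflict
  pigeonhole-edges {x} {y} u w rainbow escape with collision (col x y) (λ d → col (u d) (w d))
  ... | inj₁ (d , same) = escape d same
  ... | inj₂ (d , d' , d≢d' , same) = rainbow d d' d≢d' same

  module _ (g : Fin k → ℕ) (g≤ : ∀ d → g d ≤ k + k) (g-mono : ∀ {d d'} → r d < r d' → g d < g d') where

    private
      fan-crossing : ∀ {d d'} → Q d < Q d' → col (kv d) (S (g d)) ≡ col (kv d') (S (g d')) → Conflict
      fan-crossing {d} {d'} Qd<Qd' same =
        conflict tt tt same (from₃ (S-sorted (g-mono (r-mono Qd<Qd')) (g≤ d')) (S-before-K d (g≤ d')) Qd<Qd')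

    -- The fan edges cross pairwise: S (g d) < S (g d') < kv d < kv d' when r d < r d'.
    fan : ∀ {x y} → (∀ d → col x y ≡ col (kv d) (S (g d)) → Conflict) → Conflict
    fan = pigeonhole-edges kv (S ∘ g) rainbow
      where
      rainbow : ∀ d d' → d ≢ d' → col (kv d) (S (g d)) ≡ col (kv d') (S (g d')) → Conflict
      rainbow d d' d≢d' same with K-compare d≢d'
      ... | inj₁ Qd<Qd' = fan-crossing Qd<Qd' same
      ... | inj₂ Qd'<Qd = fan-crossing Qd'<Qd (sym same)

  module _ {c} (k₁≤c : k₁ ≤ c) (c≤k+1 : c ≤ suc k) where

    private
      star-ordered : ∀ {a b} → Q a < Q b → col (kv a) (S c) ≡ col (kv b) (S c) → Conflict
      star-ordered {a} {b} Qa<Qb same = fan g g≤ g-mono escape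
        where
        g : Fin k → ℕ
        g d = if isYes (r d <? r b) then r d else c + r d

        g≤ : ∀ d → g d ≤ k + k
        g≤ d with r d <? r b
        ... | yes _ = r≤k+k d
        ... | no _ = c+r≤k+k d c≤k+1

        g-mono : ∀ {d d'} → r d < r d' → g d < g d'
        g-mono {d} {d'} rd<rd' with r d <? r b | r d' <? r b
        ... | yes _ | yes _ = rd<rd'
        ... | yes _ | no _ = <-≤-trans rd<rd' (m≤n+m (r d') c)
        ... | no rd≮rb | yes rd'<rb = contradiction (<-trans rd<rd' rd'<rb) rd≮rb
        ... | no _ | no _ = +-monoʳ-< c rd<rd'

        escape : ∀ d → col (kv a) (S c) ≡ col (kv d) (S (g d)) → Conflict
        escape d same′ with r d <? r b
        ... | yes rd<rb =
          conflict tt tt (trans (sym same′) same)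
            (from₃ (S-sorted (<-≤-trans rd<rb (≤-trans (≤-pred (r<k b)) k₁≤c)) c≤2k) (S-before-K d c≤2k) (r-reflects rd<rb))
          where
          c≤2k : c ≤ k + k
          c≤2k = ≤-trans c≤k+1 k+1≤k+k
        ... | no rd≮rb =
          conflict tt tt same′
            (from₃ (S-sorted (m<m+n c (<-≤-trans (≤-trans (s≤s z≤n) ra<rb) rb≤rd)) (c+r≤k+k d c≤k+1))
                   (S-before-K a (c+r≤k+k d c≤k+1)) (r-reflects (<-≤-trans ra<rb rb≤rd)))
          where
          ra<rb = r-mono Qa<Qb
          rb≤rd = ≮⇒≥ rd≮rb

    star : ∀ a b → a ≢ b → col (kv a) (S c) ≡ col (kv b) (S c) → Conflict
    star a b a≢b same with K-compare a≢b
    ... | inj₁ Qa<Qb = star-ordered Qa<Qb same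
    ... | inj₂ Qb<Qa = star-ordered Qb<Qa (sym same)

    star-escape : ∀ {x y} → (∀ d → col x y ≡ col (kv d) (S c) → Conflict) → Conflict
    star-escape = pigeonhole-edges kv (λ _ → S c) star

  v : V
  v = S k

  x : Fin 3 → Fin k
  x = ch (σ k)

  W : Fin 3 → Fin 4 → V
  W = tv (σ k)

  InWindow : V → Set
  InWindow w = q (S k₁) < q w × q w < q (S (suc k))

  W≢S : ∀ {i j} n → q (W i j) ≢ q (S n)
  W≢S _ eq with q-injective eq
  ... | ()

  W≢K : ∀ {i j} a → q (W i j) ≢ Q a
  W≢K _ eq with q-injective eq
  ... | ()

  module _ (i : Fin 3) (j : Fin 4) where

    private
      w : V
      w = W i j

      fan-beyond : ∀ {b} → Q b < q w → Conflict
      fan-beyond {b} Qb<w = fan g g≤ g-mono escape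
        where
        g : Fin k → ℕ
        g d = if isYes (Q d <? q w) then r d else k + r d

        g≤ : ∀ d → g d ≤ k + k
        g≤ d with Q d <? q w
        ... | yes _ = r≤k+k d
        ... | no _ = c+r≤k+k d (n≤1+n k)

        g-mono : ∀ {d d'} → r d < r d' → g d < g d'
        g-mono {d} {d'} rd<rd' with Q d <? q w | Q d' <? q w
        ... | yes _ | yes _ = rd<rd'
        ... | yes _ | no _ = <-≤-trans (r<k d) (m≤m+n k (r d'))
        ... | no Qd≮w | yes Qd'<w = contradiction (<-trans (r-reflects rd<rd') Qd'<w) Qd≮w
        ... | no _ | no _ = +-monoʳ-< k rd<rd'

        escape : ∀ d → col v w ≡ col (kv d) (S (g d)) → Conflict
        escape d same with Q d <? q w
        ... | yes Qd<w =
          conflict refl tt same (from₄ (S-sorted (r<k d) k≤k+k) (S-before-K d k≤k+k) Qd<w)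
        ... | no Qd≮w =
          conflict′ refl tt same (from₁ (S-sorted (m<m+n k 0<rd) (c+r≤k+k d (n≤1+n k)))
                                        (<-trans (S-before-K b (c+r≤k+k d (n≤1+n k))) Qb<w) w<Qd)
          where
          w<Qd : q w < Q d
          w<Qd = ≤∧≢⇒< (≮⇒≥ Qd≮w) (W≢K d)
          0<rd : 0 < r d
          0<rd = <-≤-trans (s≤s z≤n) (r-mono (<-trans Qb<w w<Qd))

    window : InWindow w ⊎ Conflict
    window with <-cmp (q w) (q (S k₁))
    ... | tri< w<S _ _ = inj₂ (star-escape ≤-refl k₁≤k+1 λ d same →
          conflict refl tt same (from₃ w<S (S-sorted ≤-refl k≤k+k) (S-before-K d k≤k+k)))
    ... | tri≈ _ w≡S _ = contradiction w≡S (W≢S k₁)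
    ... | tri> _ _ S<w with <-cmp (q w) (q (S (suc k)))
    ...   | tri< w<S′ _ _ = inj₁ (S<w , w<S′)
    ...   | tri≈ _ w≡S′ _ = contradiction w≡S′ (W≢S (suc k))
    ...   | tri> _ _ S′<w with Finₚ.any? (λ b → Q b <? q w)
    ...     | yes (b , Qb<w) = inj₂ (fan-beyond Qb<w)
    ...     | no no-K-before-w = inj₂ (star-escape k₁≤k+1 ≤-refl λ d same →
          conflict′ refl tt same (from₁ (S-sorted ≤-refl k+1≤k+k) S′<w
                                        (≤∧≢⇒< (≮⇒≥ λ Qd<w → no-K-before-w (d , Qd<w)) (W≢K d))))

  K-agrees : ∀ {i j} → InWindow (W i j) → ∀ a → a ≢ x i → col (kv a) (W i j) ≡ col (kv a) v ⊎ Conflict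
  K-agrees {i} {j} (S<w , w<S) a a≢x with col (kv a) (W i j) Finₚ.≟ col (kv a) v
  ... | yes agree = inj₁ agree
  ... | no disagree = inj₂ (fan g g≤ g-mono escape)
    where
    -- The fan goes through kv a — v, the one fan edge that kv a — w does not cross.
    around : ∀ {d} → Tri (r d < r a) (r d ≡ r a) (r d > r a) → ℕ
    around {d} (tri< _ _ _) = r d
    around (tri≈ _ _ _) = k
    around {d} (tri> _ _ _) = k + r d

    g : Fin k → ℕ
    g d = around (<-cmp (r d) (r a))

    g≤ : ∀ d → g d ≤ k + k
    g≤ d with <-cmp (r d) (r a)
    ... | tri< _ _ _ = r≤k+k d
    ... | tri≈ _ _ _ = k≤k+k
    ... | tri> _ _ _ = c+r≤k+k d (n≤1+n k)

    squeeze : ∀ {d d'} → r d ≮ r a → r d' ≯ r a → r d ≮ r d'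
    squeeze rd≮ra rd'≯ra rd<rd' = ≤⇒≯ (≮⇒≥ rd≮ra) (<-≤-trans rd<rd' (≮⇒≥ rd'≯ra))

    g-mono : ∀ {d d'} → r d < r d' → g d < g d'
    g-mono {d} {d'} rd<rd' with <-cmp (r d) (r a) | <-cmp (r d') (r a)
    ... | tri< _ _ _ | tri< _ _ _ = rd<rd'
    ... | tri< _ _ _ | tri≈ _ _ _ = r<k d
    ... | tri< _ _ _ | tri> _ _ _ = <-≤-trans (r<k d) (m≤m+n k (r d'))
    ... | tri≈ _ _ _ | tri> _ _ ra<rd' = m<m+n k (≤-<-trans z≤n ra<rd')
    ... | tri> _ _ _ | tri> _ _ _ = +-monoʳ-< k rd<rd'
    ... | tri≈ rd≮ra _ _ | tri< _ _ rd'≯ra = contradiction rd<rd' (squeeze rd≮ra rd'≯ra)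
    ... | tri≈ rd≮ra _ _ | tri≈ _ _ rd'≯ra = contradiction rd<rd' (squeeze rd≮ra rd'≯ra)
    ... | tri> rd≮ra _ _ | tri< _ _ rd'≯ra = contradiction rd<rd' (squeeze rd≮ra rd'≯ra)
    ... | tri> rd≮ra _ _ | tri≈ _ _ rd'≯ra = contradiction rd<rd' (squeeze rd≮ra rd'≯ra)

    escape : ∀ d → col (kv a) (W i j) ≡ col (kv d) (S (g d)) → Conflict
    escape d same with <-cmp (r d) (r a)
    ... | tri< rd<ra _ _ =
      conflict′ a≢x tt same (from₂ (<-trans (S-sorted (<-≤-trans rd<ra (≤-pred (r<k a))) (≤-trans (n≤1+n k₁) k≤k+k)) S<w)
                                  (<-trans w<S (S-before-K d k+1≤k+k)) (r-reflects rd<ra))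
    ... | tri≈ _ rd≡ra _ with r-injective rd≡ra
    ...   | refl = contradiction same disagree
    escape d same | tri> _ _ ra<rd =
      conflict a≢x tt same (from₃ (<-≤-trans w<S (S-mono (m<m+n k (≤-<-trans z≤n ra<rd)) k+rd≤k+k))
                                 (S-before-K a k+rd≤k+k) (r-reflects ra<rd))
      where
      k+rd≤k+k : k + r d ≤ k + k
      k+rd≤k+k = c+r≤k+k d (n≤1+n k)

  v-agrees : ∀ {i j i' j'} → InWindow (W i j) → InWindow (W i' j') → Between (q v) (q (W i' j')) (q (W i j)) →
             col v (W i' j') ≡ col (kv (x i)) v ⊎ Conflict
  v-agrees {i} {j} {i'} {j'} w-in w'-in w-between with col v (W i' j') Finₚ.≟ col (kv (x i)) v
  ... | yes agree = inj₁ agree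
  ... | no disagree = inj₂ (star-escape (n≤1+n k₁) (n≤1+n k) escape)
    where
    escape : ∀ d → col v (W i' j') ≡ col (kv d) v → Conflict
    escape d same with d Finₚ.≟ x i
    ... | yes refl = contradiction same disagree
    ... | no d≢x with K-agrees w-in d d≢x
    ...   | inj₂ found = found
    ...   | inj₁ agree = crossing w-between
      where
      crossing : Between (q v) (q (W i' j')) (q (W i j)) → Conflict
      crossing (inj₁ (v<w , w<w')) =
        conflict′ refl d≢x (trans same (sym agree)) (from₁ v<w w<w' (<-trans (proj₂ w'-in) (S-before-K d k+1≤k+k)))
      crossing (inj₂ (w'<w , w<v)) =
        conflict refl d≢x (trans same (sym agree)) (from₃ w'<w w<v (S-before-K d k≤k+k))

  nested-conflict : ∀ {ia ja ib jb iz jz} → InWindow (W ia ja) → InWindow (W ib jb) → InWindow (W iz jz) →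
                    Between (q v) (q (W iz jz)) (q (W ia ja)) → Between (q v) (q (W iz jz)) (q (W ib jb)) →
                    x ia ≢ x ib → Conflict
  nested-conflict a-in b-in z-in a-between b-between xa≢xb
    with v-agrees a-in z-in a-between | v-agrees b-in z-in b-between
  ... | inj₁ agree-a | inj₁ agree-b = star (n≤1+n k₁) (n≤1+n k) _ _ xa≢xb (trans (sym agree-a) agree-b)
  ... | inj₂ found | _ = found
  ... | _ | inj₂ found = found

  W-injective : ∀ {i j i' j'} → W i j ≡ W i' j' → i ≡ i' × j ≡ j'
  W-injective refl = refl , refl

  side-of : ∀ i j → ∃ λ s → Order s (q v) (q (W i j))
  side-of i j = Order-total (W≢S k ∘ sym)

  record SameSide : Set where
    field
      s : Fin 2
      class : Fin 2 → Fin 3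
      member : Fin 2 → Fin 2 → Fin 4
      classes-differ : x (class zero) ≢ x (class (suc zero))
      members-differ : ∀ c → member c zero ≢ member c (suc zero)
      on-side : ∀ c m → Order s (q v) (q (W (class c) (member c m)))

  private
    sideOf : Fin 3 → Fin 4 → Fin 2
    sideOf i j = proj₁ (side-of i j)

    opaque
      side-pair : ∀ i → ∃₂ λ j j' → j Fin.< j' × sideOf i j ≡ sideOf i j'
      side-pair i = Finₚ.pigeonhole (s≤s (s≤s (s≤s z≤n))) (sideOf i)

    pair-member : Fin 3 → Fin 2 → Fin 4
    pair-member i zero = proj₁ (side-pair i)
    pair-member i (suc zero) = proj₁ (proj₂ (side-pair i))

    pair-side : ∀ i m → sideOf i (pair-member i m) ≡ sideOf i (pair-member i zero)
    pair-side i zero = refl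
    pair-side i (suc zero) = sym (proj₂ (proj₂ (proj₂ (side-pair i))))

    opaque
      class-pair : ∃₂ λ i i' → i Fin.< i' × sideOf i (pair-member i zero) ≡ sideOf i' (pair-member i' zero)
      class-pair = Finₚ.pigeonhole (s≤s (s≤s (s≤s z≤n))) (λ i → sideOf i (pair-member i zero))

  same-side : ValidChoice k ch → SameSide
  same-side valid with class-pair
  ... | i₁ , i₂ , i₁<i₂ , same = record
    { s = sideOf i₁ (pair-member i₁ zero)
    ; class = class
    ; member = pair-member ∘ class
    ; classes-differ = Finₚ.<⇒≢ i₁<i₂ ∘ valid (σ k)
    ; members-differ = λ c → Finₚ.<⇒≢ (proj₁ (proj₂ (proj₂ (side-pair (class c)))))
    ; on-side = λ c m → subst (λ s → Order s (q v) (q (W (class c) (pair-member (class c) m))))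
                             (trans (pair-side (class c) m) (class-side c)) (proj₂ (side-of _ _))
    }
    where
    class : Fin 2 → Fin 3
    class zero = i₁
    class (suc zero) = i₂

    class-side : ∀ c → sideOf (class c) (pair-member (class c) zero) ≡ sideOf i₁ (pair-member i₁ zero)
    class-side zero = refl
    class-side (suc zero) = sym same

  conflict-exists : ValidChoice k ch → Conflict
  conflict-exists valid = [ nested , id ]′ (∀-⊎ λ c → ∀-⊎ λ m → window (class c) (member c m))
    where
    open SameSide (same-side valid)

    point : Fin 2 → Fin 2 → ℕ
    point c m = q (W (class c) (member c m))

    in-class : ∀ c → point c zero ≢ point c (suc zero)
    in-class c eq = members-differ c (proj₂ (W-injective (q-injective eq)))

    apart : ∀ m m' → point zero m ≢ point (suc zero) m'
    apart m m' eq = classes-differ (cong x (proj₁ (W-injective (q-injective eq))))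

    nested : (∀ c m → InWindow (W (class c) (member c m))) → Conflict
    nested in-window with farthest (Order-isStrictTotalOrder s) point in-class apart
    ... | c , m , m₀ , m₁ , a≺z , b≺z =
      nested-conflict (in-window zero m₀) (in-window (suc zero) m₁) (in-window c m)
        (Order-Between s (on-side zero m₀) a≺z) (Order-Between s (on-side (suc zero) m₁) b≺z) classes-differ

module Linearisation (k₁ : ℕ) (pos : QV (suc k₁) → ℕ) (pos-injective : Injective _≡_ _≡_ pos) where

  private
    k : ℕ
    k = suc k₁

    Bᵏ Bˢ Bᵗ B : ℕ
    Bᵏ = sup (pos ∘ kv)
    Bˢ = sup (pos ∘ sv)
    Bᵗ = sup λ s → sup λ i → sup λ j → pos (tv s i j)
    B = Bᵏ ⊔ (Bˢ ⊔ Bᵗ)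

    pos≤B : ∀ x → pos x ≤ B
    pos≤B (kv a) = ≤-trans (≤-sup (pos ∘ kv) a) (m≤m⊔n Bᵏ (Bˢ ⊔ Bᵗ))
    pos≤B (sv s) = ≤-trans (≤-sup (pos ∘ sv) s) (≤-trans (m≤m⊔n Bˢ Bᵗ) (m≤n⊔m Bᵏ (Bˢ ⊔ Bᵗ)))
    pos≤B (tv s i j) = ≤-trans (≤-sup (pos ∘ tv s i) j) (≤-trans (≤-sup (λ i → sup (pos ∘ tv s i)) i)
                         (≤-trans (≤-sup (λ s → sup λ i → sup (pos ∘ tv s i)) s)
                           (≤-trans (m≤n⊔m Bˢ Bᵗ) (m≤n⊔m Bᵏ (Bˢ ⊔ Bᵗ)))))

    module R₁ = Rotation B (suc (pos (kv zero)))

    q₁ : QV k → ℕ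
    q₁ = R₁.rotate ∘ pos

    q₁≤ : ∀ x → q₁ x ≤ suc (B + B)
    q₁≤ x = R₁.rotate-≤ (pos≤B x)

    q₁-injective : Injective _≡_ _≡_ q₁
    q₁-injective = pos-injective ∘ R₁.rotate-injective (pos≤B _) (pos≤B _)

    gap : Fin (sSize k) → ℕ
    gap s = rank (q₁ ∘ kv) (q₁ (sv s))

    gap<k : ∀ s → gap s < k
    gap<k s = rank-< (q₁ ∘ kv) zero (R₁.rotate-≤-last refl (pos≤B (sv s)))

    opaque
      sorted : Σ (ℕ → Fin (sSize k)) λ σ₀ →
               ∀ {i j} → i < j → j ≤ 2 * (k * k) → q₁ (sv (σ₀ i)) < q₁ (sv (σ₀ j))
      sorted = sorted-enumeration _ (q₁ ∘ sv) (sv-injective ∘ q₁-injective)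
        where
        sv-injective : ∀ {s s'} → sv {k} s ≡ sv s' → s ≡ s'
        sv-injective refl = refl

    σ₀ : ℕ → Fin (sSize k)
    σ₀ = proj₁ sorted

    k*2k : k * (k + k) ≡ 2 * (k * k)
    k*2k = trans (*-distribˡ-+ k k k) (cong (k * k +_) (sym (+-identityʳ (k * k))))

    σ₀-mono : ∀ {i j} → i ≤ j → j ≤ k * (k + k) → q₁ (sv (σ₀ i)) ≤ q₁ (sv (σ₀ j))
    σ₀-mono {i} {j} i≤j j≤ with m≤n⇒m<n∨m≡n i≤j
    ... | inj₁ i<j = <⇒≤ (proj₂ sorted i<j (≤-trans j≤ (≤-reflexive k*2k)))
    ... | inj₂ refl = ≤-refl

    opaque
      plateau : ∃ λ j₀ → (k + k) + j₀ ≤ k * (k + k) × gap (σ₀ j₀) ≡ gap (σ₀ ((k + k) + j₀))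
      plateau = monotone-plateau k (k + k) (gap ∘ σ₀) (λ i≤j j≤ → rank-mono (q₁ ∘ kv) (σ₀-mono i≤j j≤)) (gap<k _)

  σ : ℕ → Fin (sSize k)
  σ i = σ₀ (i + proj₁ plateau)

  private
    S-bound : ∀ {j} → j ≤ k + k → j + proj₁ plateau ≤ 2 * (k * k)
    S-bound j≤2k = ≤-trans (+-monoˡ-≤ (proj₁ plateau) j≤2k) (≤-trans (proj₁ (proj₂ plateau)) (≤-reflexive k*2k))

    S-sorted-q₁ : ∀ {i j} → i < j → j ≤ k + k → q₁ (sv (σ i)) < q₁ (sv (σ j))
    S-sorted-q₁ i<j j≤2k = proj₂ sorted (+-monoˡ-< (proj₁ plateau) i<j) (S-bound j≤2k)

    S-least : ∀ {j} → j ≤ k + k → q₁ (sv (σ 0)) ≤ q₁ (sv (σ j))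
    S-least {zero} _ = ≤-refl
    S-least {suc j} j≤2k = <⇒≤ (S-sorted-q₁ (s≤s z≤n) j≤2k)

    K-outside-window : ∀ a → q₁ (sv (σ 0)) ≤ q₁ (kv a) → q₁ (sv (σ (k + k))) < q₁ (kv a)
    K-outside-window a S₀≤K with <-cmp (q₁ (sv (σ (k + k)))) (q₁ (kv a))
    ... | tri< S<K _ _ = S<K
    ... | tri≈ _ S≡K _ with q₁-injective S≡K
    ...   | ()
    K-outside-window a S₀≤K | tri> _ _ K<S =
      contradiction (proj₂ (proj₂ plateau)) (<⇒≢ (rank-strict (q₁ ∘ kv) a S₀≤K K<S))

    module R₂ = Rotation (suc (B + B)) (q₁ (sv (σ 0)))

  q : QV k → ℕ
  q = R₂.rotate ∘ q₁

  q-injective : Injective _≡_ _≡_ q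
  q-injective = q₁-injective ∘ R₂.rotate-injective (q₁≤ _) (q₁≤ _)

  q-cross : ∀ {a b c d} → Cyclic (q a) (q c) (q b) (q d) → Cross pos a b c d
  q-cross = Cyclic⇒Cross pos ∘ R₁.rotate-cyclic (pos≤B _) (pos≤B _) (pos≤B _) (pos≤B _)
                             ∘ R₂.rotate-cyclic (q₁≤ _) (q₁≤ _) (q₁≤ _) (q₁≤ _)

  S-sorted : ∀ {i j} → i < j → j ≤ k + k → q (sv (σ i)) < q (sv (σ j))
  S-sorted i<j j≤2k = R₂.rotate-kept-mono (S-least (≤-trans (<⇒≤ i<j) j≤2k)) (S-sorted-q₁ i<j j≤2k)

  S<K : ∀ a → q (sv (σ (k + k))) < q (kv a)
  S<K a = [ (λ S₀≤K → R₂.rotate-kept-mono (S-least ≤-refl) (K-outside-window a S₀≤K))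
          , R₂.rotate-kept<moved (q₁≤ _) (S-least ≤-refl)
          ]′ (≤-<-connex (q₁ (sv (σ 0))) (q₁ (kv a)))

lemma6 : (k : ℕ) → 3 ≤ k → (ch : Choice k) → ValidChoice k ch →
         BookThicknessGT (Adj k ch) k
lemma6 (suc k₁) _ ch valid pos pos-injective col _ =
  Core.conflict-exists k₁ ch pos col q q-injective q-cross σ S-sorted S<K valid
  where
  open Linearisation k₁ pos pos-injective
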